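{- Let $N$ be a nested set of separations of a connected locally finite graph $G$, let $((A_i,B_i))_{i\in\mathbb N}$ be a strictly increasing sequence of tight separations in $\vec N$, and let $(A,B)=(\bigcup_iA_i,\bigcap_iB_i)$ be its limit. Suppose $((A_i,B_i))_{i}$ is non-exhaustive (i.e. $B\ne\emptyset$) and $N$ distinguishes all pre-tangles in $G$ that are induced by ends in the closure of $A\cap B$ (i.e. any two such pre-tangles distinguished by some separation of $G$ are distinguished by some element of $N$). Then precisely one end of $G$ lies in the closure of $A\cap B$.
   Context: A separation of a graph $G$ is an unordered pair $\{A,B\}$ of subsets of $V(G)$ with $A\cup B=V(G)$ and no edge between $A\setminus B$ and $B\setminus A$; its order is $|A\cap B|$; $\vec N$ is the set of all orientations $(A,B),(B,A)$ of elements of $N$; oriented separations are ordered by $(A,B)\le(C,D)$ iff $A\subseteq C$ and $B\supseteq D$. Separations are nested if they have comparable orientations; a set is nested if pairwise nested. For $X\subseteq V(G)$, a component $K$ of $G-X$ is tight if $N_G(K)=X$; a separation $\{A,B\}$ is tight if both $A\setminus B$ and $B\setminus A$ contain the vertex set of a tight component of $G-(A\cap B)$. A separation distinguishes two pre-tangles if both contain one of its orientations but not the same one. For an end $\omega$, the induced pre-tangle $P_\omega$ consists of all oriented finite-order separations $(A,B)$ such that the component of $G-(A\cap B)$ containing a tail of some (equivalently every) ray in $\omega$ lies in $B\setminus A$. A comb is the union of a ray $R$ (its spine) with infinitely many disjoint finite paths each having precisely its first vertex on $R$; their last vertices are its teeth. An end $\omega$ lies in the closure of $U\subseteq V(G)$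 if $G$ contains a comb with all teeth in $U$ and spine in $\omega$. -}

module Defs where

open import Level using (0ℓ) renaming (suc to lsuc)
open import Data.Nat using (ℕ; zero; suc; _≤_; _<_)
open import Data.Fin using (Fin; inject₁; fromℕ) renaming (zero to fzero; suc to fsuc)
open import Data.List using (List)
open import Data.List.Membership.Propositional using (_∈_)
open import Data.Product using (Σ; _×_; _,_; proj₁; proj₂)
open import Data.Sum using (_⊎_)
open import Data.Empty using (⊥)
open import Data.Unit using (⊤)
open import Relation.Nullary using (¬_)
open import Relation.Binary.PropositionalEquality using (_≡_; _≢_)

record Graph : Set₁ where
  field
    V        : Set
    E        : V → V → Set
    E-sym    : ∀ {u v} → E u v → E v u
    E-irrefl : ∀ {v} → ¬ E v v

module _ (G : Graph) where
  open Graph G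

  VSet : Set₁
  VSet = V → Set

  _∩_ : VSet → VSet → VSet
  (X ∩ Y) v = X v × Y v

  _∖_ : VSet → VSet → VSet
  (X ∖ Y) v = X v × ¬ Y v

  _⊆_ : VSet → VSet → Set
  X ⊆ Y = ∀ v → X v → Y v

  _≐_ : VSet → VSet → Set
  X ≐ Y = X ⊆ Y × Y ⊆ X

  Finite : VSet → Set
  Finite X = Σ (List V) λ xs → ∀ v → X v → v ∈ xs

  data Walk (P : VSet) : V → V → Set where
    here : ∀ {x} → P x → Walk P x x
    step : ∀ {x y z} → P x → E x y → Walk P y z → Walk P x z

  Connected : Set
  Connected = ∀ u v → Walk (λ _ → ⊤) u v

  LocallyFinite : Set
  LocallyFinite = ∀ v → Σ (List V) λ xs → ∀ u → E v u → u ∈ xs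

  IsSeparation : VSet → VSet → Set
  IsSeparation A B =
    (∀ v → A v ⊎ B v) × (∀ u v → E u v → (A ∖ B) u → (B ∖ A) v → ⊥)

  OSep : Set₁
  OSep = VSet × VSet

  _≤ₛ_ : OSep → OSep → Set
  (A , B) ≤ₛ (C , D) = A ⊆ C × D ⊆ B

  _<ₛ_ : OSep → OSep → Set
  (A , B) <ₛ (C , D) = ((A , B) ≤ₛ (C , D)) × ¬ (A ≐ C × B ≐ D)

  -- a set of (unoriented) separations: N A B means {A,B} ∈ N
  SepSet : Set₂
  SepSet = VSet → VSet → Set₁

  _∈⃗_ : OSep → SepSet → Set₁
  (A , B) ∈⃗ N = N A B ⊎ N B A

  NestedPair : VSet → VSet → VSet → VSet → Set
  NestedPair A B C D =
    ((A , B) ≤ₛ (C , D)) ⊎ ((A , B) ≤ₛ (D , C)) ⊎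
    ((B , A) ≤ₛ (C , D)) ⊎ ((B , A) ≤ₛ (D , C))

  IsNestedSet : SepSet → Set₁
  IsNestedSet N = ∀ {A B C D} → N A B → N C D → NestedPair A B C D

  IsComponent : VSet → VSet → Set
  IsComponent X K =
    Σ V K
    × (∀ v → K v → ¬ X v)
    × (∀ u v → K u → K v → Walk K u v)
    × (∀ u v → K u → ¬ X v → E u v → K v)

  Nbhd : VSet → VSet
  Nbhd K v = ¬ K v × Σ V λ u → K u × E u v

  IsTightComponent : VSet → VSet → Set
  IsTightComponent X K = IsComponent X K × (Nbhd K ≐ X)

  IsTightSep : VSet → VSet → Set₁
  IsTightSep A B =
    IsSeparation A B
    × Σ VSet (λ K → IsTightComponent (A ∩ B) K × K ⊆ (A ∖ B))
    × Σ VSet (λ K → IsTightComponent (A ∩ B) K × K ⊆ (B ∖ A))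

  -- Rays and ends (an end is represented by any of its rays)

  record Ray : Set where
    field
      r     : ℕ → V
      r-inj : ∀ m n → r m ≡ r n → m ≡ n
      r-adj : ∀ n → E (r n) (r (suc n))
  open Ray public

  _~_ : Ray → Ray → Set
  R ~ R' = ∀ (S : List V) → Σ ℕ λ n → Σ ℕ λ m →
      (∀ k → n ≤ k → ¬ (r R k ∈ S))
    × (∀ k → m ≤ k → ¬ (r R' k ∈ S))
    × Walk (λ v → ¬ (v ∈ S)) (r R n) (r R' m)

  record FinPath : Set where
    field
      len  : ℕ
      pv   : Fin (suc len) → V
      pinj : ∀ i j → pv i ≡ pv j → i ≡ j
      padj : ∀ (i : Fin len) → E (pv (inject₁ i)) (pv (fsuc i))
  open FinPath public

  firstV lastV : FinPath → V
  firstV P = pv P fzero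
  lastV P = pv P (fromℕ (len P))

  IsCombWith : Ray → VSet → Set
  IsCombWith S U = Σ (ℕ → FinPath) λ P →
      (∀ i → Σ ℕ λ n → firstV (P i) ≡ r S n)
    × (∀ i j n → pv (P i) j ≡ r S n → j ≡ fzero)
    × (∀ i i' → i ≢ i' → ∀ j j' → pv (P i) j ≢ pv (P i') j')
    × (∀ i → U (lastV (P i)))

  InClosure : VSet → Ray → Set
  InClosure U R = Σ Ray λ S → (S ~ R) × IsCombWith S U

  PreTangleOf : Ray → OSep → Set
  PreTangleOf R (A , B) =
    IsSeparation A B × Finite (A ∩ B) ×
    Σ ℕ λ n → (∀ k → n ≤ k → ¬ (A ∩ B) (r R k))
            × (∀ v → Walk (λ w → ¬ (A ∩ B) w) (r R n) v → (B ∖ A) v)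

  Distinguishes : VSet → VSet → (OSep → Set) → (OSep → Set) → Set
  Distinguishes C D P Q =
    (P (C , D) ⊎ P (D , C)) × (Q (C , D) ⊎ Q (D , C))
    × ¬ ((P (C , D) × Q (C , D)) ⊎ (P (D , C) × Q (D , C)))

  LimA : (ℕ → VSet) → VSet
  LimA As v = Σ ℕ λ i → As i v

  LimB : (ℕ → VSet) → VSet
  LimB Bs v = ∀ i → Bs i v

{-# OPTIONS --safe #-}
-- Let U = A ∩ B. Once a stage A_i contains a finite U together with all neighbours of U in A,
-- tightness of (A_i, B_i) puts its separator inside U; a vertex added at stage i+1 is then
-- joined to U by a walk through A ∖ (A_i ∪ B) whose last vertex is a neighbour of U in A
-- missing from A_i. Hence U is infinite, and König's lemma on a breadth-first tree of the
-- connected locally finite graph yields a comb with teeth in U. Two inequivalent ends in the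
-- closure of U are distinguished by a finite separation, hence by some {C, D} ∈ N. By
-- nestedness a side of every (A_i, B_i) lies in C or in D, so U lies on one side of {C, D};
-- but the comb of the end living on the other side has a tooth path avoiding the finite
-- separator C ∩ D, so some tooth is on that other side.
module Submission where

open import Defs
open import Level using (0ℓ) renaming (suc to lsuc; _⊔_ to _⊔ˡ_)
open import Axiom.ExcludedMiddle using (ExcludedMiddle)
open import Axiom.DoubleNegationElimination using (em⇒dne)
open import Data.Nat using (ℕ; zero; suc; _+_; _∸_; _≤_; _<_; z≤n; s≤s; z<s; _⊔_)
open import Data.Nat.Properties
open import Data.Nat.Induction using (<-rec)
open import Data.Product using (Σ; _×_; _,_; proj₁; proj₂)
open import Data.Sum using (_⊎_; inj₁; inj₂)
import Data.Sum
import Data.Product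
open import Data.Empty using (⊥; ⊥-elim)
open import Data.Unit using (⊤)
open import Data.List using (List; []; _∷_; _++_; length; lookup; concatMap)
open import Data.List.Relation.Unary.Any as Any using (here; there)
open import Data.List.Relation.Unary.Any.Properties using (lookup-index)
open import Data.Fin as Fin using (Fin; join; splitAt)
open import Data.Fin.Properties
  using (pigeonhole; splitAt-join; toℕ-fromℕ<; toℕ-fromℕ; toℕ<n; toℕ-injective; toℕ-inject₁)
open import Data.List.Membership.Propositional using (_∈_; _∉_; lose)
open import Data.List.Membership.Propositional.Properties using (∈-++⁺ˡ; ∈-++⁺ʳ; ∈-concatMap⁺)
open import Function using (_∘_)
open import Relation.Nullary using (¬_; yes; no)
open import Relation.Binary.Definitions using (tri<; tri≈; tri>)
open import Relation.Binary.PropositionalEquality using (_≡_; _≢_; refl; sym; trans; cong; subst; subst₂)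

module Classical (em : ExcludedMiddle 0ℓ) where

  dne : {P : Set} → ¬ ¬ P → P
  dne = em⇒dne em

  ¬∀⇒∃¬ : {A : Set} {B : A → Set} → ¬ (∀ a → B a) → Σ A λ a → ¬ B a
  ¬∀⇒∃¬ ¬∀ = dne λ ¬∃ → ¬∀ λ a → dne λ ¬b → ¬∃ (a , ¬b)

  Least Greatest : (ℕ → Set) → ℕ → Set
  Least P m = P m × (∀ k → k < m → ¬ P k)
  Greatest P m = P m × (∀ k → m < k → ¬ P k)

  least : (P : ℕ → Set) → Σ ℕ P → Σ ℕ (Least P)
  least P (n , pn) = <-rec (λ n → P n → Σ ℕ (Least P)) descend n pn
    where
    descend : ∀ n → (∀ {k} → k < n → P k → Σ ℕ (Least P)) → P n → Σ ℕ (Least P)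
    descend n below pn with em {Σ ℕ λ k → k < n × P k}
    ... | yes (k , k<n , pk) = below k<n pk
    ... | no ¬smaller = n , pn , λ k k<n pk → ¬smaller (k , k<n , pk)

  -- the greatest m ≤ b with P m is b ∸ k for the least k with P (b ∸ k)
  greatest : (P : ℕ → Set) (b : ℕ) → (∀ m → P m → m ≤ b) → Σ ℕ P → Σ ℕ (Greatest P)
  greatest P b bounded (n , pn) =
    let k , pk , minimal = least (λ k → P (b ∸ k)) (b ∸ n , reflect n pn)
    in b ∸ k , pk , λ m b∸k<m pm → minimal (b ∸ m) (b∸m<k m b∸k<m (bounded m pm)) (reflect m pm)
    where
    reflect : ∀ m → P m → P (b ∸ (b ∸ m))
    reflect m pm = subst P (sym (m∸[m∸n]≡n (bounded m pm))) pm
    b∸m<k : ∀ {k} m → b ∸ k < m → m ≤ b → b ∸ m < k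
    b∸m<k {k} m b∸k<m m≤b = ≰⇒> λ k≤b∸m →
      <⇒≱ b∸k<m (≤-trans (≤-reflexive (sym (m∸[m∸n]≡n m≤b))) (∸-monoʳ-≤ b k≤b∸m))

module Walks (G : Graph) where
  open Graph G

  walk-start : ∀ {P x y} → Walk G P x y → P x
  walk-start (here p) = p
  walk-start (step p _ _) = p

  walk-end : ∀ {P x y} → Walk G P x y → P y
  walk-end (here p) = p
  walk-end (step _ _ w) = walk-end w

  infixr 5 _++ʷ_

  _++ʷ_ : ∀ {P x y z} → Walk G P x y → Walk G P y z → Walk G P x z
  here _ ++ʷ w′ = w′
  step p e w ++ʷ w′ = step p e (w ++ʷ w′)

  extendʷ : ∀ {P x y z} → Walk G P x y → E y z → P z → Walk G P x z
  extendʷ w e pz = w ++ʷ step (walk-end w) e (here pz)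

  reverseʷ : ∀ {P x y} → Walk G P x y → Walk G P y x
  reverseʷ (here p) = here p
  reverseʷ (step p e w) = extendʷ (reverseʷ w) (E-sym e) p

  mapʷ : ∀ {P Q : VSet G} {x y} → _⊆_ G P Q → Walk G P x y → Walk G Q x y
  mapʷ f (here p) = here (f _ p)
  mapʷ f (step p e w) = step (f _ p) e (mapʷ f w)

  transportʷ : ∀ {P : VSet G} (Q : VSet G) → (∀ {u v} → P u → P v → E u v → Q u → Q v)
             → ∀ {x y} → Walk G P x y → Q x → Q y
  transportʷ Q preserved (here _) q = q
  transportʷ Q preserved (step p e w) q = transportʷ Q preserved w (preserved p (walk-start w) e q)

  ray-walk : ∀ (R : Ray G) {P : VSet G} {a} b → a ≤ b → (∀ j → a ≤ j → P (r R j))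
           → Walk G P (r R a) (r R b)
  ray-walk R zero z≤n tail = here (tail 0 z≤n)
  ray-walk R (suc b) a≤1+b tail with m≤n⇒m<n∨m≡n a≤1+b
  ... | inj₂ refl = here (tail (suc b) ≤-refl)
  ... | inj₁ (s≤s a≤b) = extendʷ (ray-walk R b a≤b tail) (r-adj R b) (tail (suc b) (m≤n⇒m≤1+n a≤b))

  path-walk : ∀ {P : VSet G} (π : FinPath G) → (∀ i → P (pv π i)) → Walk G P (firstV G π) (lastV G π)
  path-walk {P} π onP = go (len π) (pv π) (padj π) onP
    where
    go : ∀ n (f : Fin (suc n) → V) → (∀ (i : Fin n) → E (f (Fin.inject₁ i)) (f (Fin.suc i)))
       → (∀ i → P (f i)) → Walk G P (f Fin.zero) (f (Fin.fromℕ n))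
    go zero f adj onP = here (onP Fin.zero)
    go (suc n) f adj onP = step (onP Fin.zero) (adj Fin.zero)
      (go n (λ i → f (Fin.suc i)) (λ i → adj (Fin.suc i)) (λ i → onP (Fin.suc i)))

module Separations (em : ExcludedMiddle 0ℓ) (G : Graph) where
  open Graph G
  open Classical em
  open Walks G

  separation-swap : ∀ {X Y} → IsSeparation G X Y → IsSeparation G Y X
  separation-swap (covers , no-edge) = Data.Sum.swap ∘ covers , λ u v e Y∖X X∖Y → no-edge v u (E-sym e) X∖Y Y∖X

  covers-other : ∀ {X Y v} → IsSeparation G X Y → ¬ X v → Y v
  covers-other (covers , _) ¬Xv = Data.Sum.[ (λ Xv → ⊥-elim (¬Xv Xv)) , (λ Yv → Yv) ]′ (covers _)

  neighbour-stays : ∀ {X Y u w} → IsSeparation G X Y → (_∖_ G X Y) u → E u w → X w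
  neighbour-stays sep u∈X∖Y e = dne λ ¬Xw → proj₂ sep _ _ e u∈X∖Y (covers-other sep ¬Xw , ¬Xw)

  stays-on-side : ∀ {X Y P x y} → IsSeparation G X Y → (∀ v → P v → ¬ (_∩_ G X Y) v)
    → Walk G P x y → (_∖_ G X Y) x → (_∖_ G X Y) y
  stays-on-side {X} {Y} sep avoids = transportʷ (_∖_ G X Y) λ _ Pw e u∈X∖Y →
    let Xw = neighbour-stays sep u∈X∖Y e in Xw , λ Yw → avoids _ Pw (Xw , Yw)

  walk-crosses-separator : ∀ {X Y P x y} → IsSeparation G X Y → Walk G P x y → X x → Y y → Σ V (_∩_ G X Y)
  walk-crosses-separator {X} {Y} {x = x} sep w Xx Yy = dne λ ¬crossed →
    proj₂ (stays-on-side sep (λ v _ X∩Y → ¬crossed (v , X∩Y)) w (Xx , λ Yx → ¬crossed (x , Xx , Yx))) Yy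

  walk-enters : ∀ {Z P : VSet G} {x y} → Walk G P x y → ¬ Z x → Z y
    → Σ V λ u → Σ V λ w → Walk G (λ v → ¬ Z v) x u × E u w × Z w
  walk-enters (here _) ¬Zx Zy = ⊥-elim (¬Zx Zy)
  walk-enters {Z} {x = x} (step {y = x′} _ e w) ¬Zx Zy with em {Z x′}
  ... | yes Zx′ = x , x′ , here ¬Zx , e , Zx′
  ... | no ¬Zx′ with walk-enters w ¬Zx′ Zy
  ... | u , u′ , x′→u , e′ , Zu′ = u , u′ , step ¬Zx e x′→u , e′ , Zu′

  <ₛ⇒new-vertex : ∀ {X Y X′ Y′} → IsSeparation G X′ Y′ → _<ₛ_ G (X , Y) (X′ , Y′)
    → _⊆_ G (_∩_ G X Y) Y′ → Σ V λ v → X′ v × ¬ X v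
  <ₛ⇒new-vertex {X} {Y} {X′} {Y′} sep′ ((X⊆X′ , Y′⊆Y) , ¬same) X∩Y⊆Y′ =
    dne λ ¬new → ¬same ((X⊆X′ , X′⊆X ¬new) , (Y⊆Y′ ¬new , Y′⊆Y))
    where
    NoNew : Set
    NoNew = ¬ (Σ V λ v → X′ v × ¬ X v)
    X′⊆X : NoNew → _⊆_ G X′ X
    X′⊆X ¬new v X′v = dne λ ¬Xv → ¬new (v , X′v , ¬Xv)
    Y⊆Y′ : NoNew → _⊆_ G Y Y′
    Y⊆Y′ ¬new v Yv with em {X v}
    ... | yes Xv = X∩Y⊆Y′ v (Xv , Yv)
    ... | no ¬Xv = covers-other sep′ (¬Xv ∘ X′⊆X ¬new v)

  SideWithin : VSet G → VSet G → VSet G → VSet G → Set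
  SideWithin A B X Y = (_⊆_ G A X ⊎ _⊆_ G A Y) ⊎ (_⊆_ G B X ⊎ _⊆_ G B Y)

  side-within-swapˡ : ∀ {A B X Y} → SideWithin A B X Y → SideWithin B A X Y
  side-within-swapˡ = Data.Sum.swap

  side-within-swapʳ : ∀ {A B X Y} → SideWithin A B X Y → SideWithin A B Y X
  side-within-swapʳ = Data.Sum.map Data.Sum.swap Data.Sum.swap

  nested⇒side-within : ∀ {A B X Y} → NestedPair G A B X Y → SideWithin A B X Y
  nested⇒side-within (inj₁ (A⊆X , _)) = inj₁ (inj₁ A⊆X)
  nested⇒side-within (inj₂ (inj₁ (A⊆Y , _))) = inj₁ (inj₂ A⊆Y)
  nested⇒side-within (inj₂ (inj₂ (inj₁ (B⊆X , _)))) = inj₂ (inj₁ B⊆X)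
  nested⇒side-within (inj₂ (inj₂ (inj₂ (B⊆Y , _)))) = inj₂ (inj₂ B⊆Y)

module Ends (em : ExcludedMiddle 0ℓ) (G : Graph) where
  open Graph G
  open Classical em
  open Walks G
  open Separations em G

  ray-eventually-avoids : (R : Ray G) (L : List V) → Σ ℕ λ n → ∀ k → n ≤ k → r R k ∉ L
  ray-eventually-avoids R [] = 0 , λ _ _ ()
  ray-eventually-avoids R (x ∷ L) with ray-eventually-avoids R L | em {Σ ℕ λ k → r R k ≡ x}
  ... | n , avoids | no off-ray = n , λ where
    k n≤k (here eq) → off-ray (k , eq)
    k n≤k (there k∈L) → avoids k n≤k k∈L
  ... | n , avoids | yes (k₀ , eq₀) = suc k₀ ⊔ n , λ where
    k le (here eq) → <⇒≢ (≤-trans (m≤m⊔n (suc k₀) n) le) (r-inj R k₀ k (trans eq₀ (sym eq)))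
    k le (there k∈L) → avoids k (≤-trans (m≤n⊔m (suc k₀) n) le) k∈L

  ~-refl : ∀ R → _~_ G R R
  ~-refl R L with ray-eventually-avoids R L
  ... | n , avoids = n , n , avoids , avoids , here (avoids n ≤-refl)

  disjoint-paths-avoid : (P : ℕ → FinPath G) (S : Ray G) (s : ℕ → ℕ)
    → (∀ i → firstV G (P i) ≡ r S (s i))
    → (∀ i i′ → i ≢ i′ → ∀ j j′ → pv (P i) j ≢ pv (P i′) j′)
    → (Z : List V) (n : ℕ) → Σ ℕ λ i → n ≤ s i × (∀ j → pv (P i) j ∉ Z)
  disjoint-paths-avoid P S s first disjoint Z n = dne λ ¬good → collision (λ i → classify i (¬good ∘ (i ,_)))
    where
    Good : ℕ → Set
    Good i = n ≤ s i × (∀ j → pv (P i) j ∉ Z)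

    -- a bad path is witnessed by its start below n or by a vertex of Z on it
    Witness : ℕ → Fin n ⊎ Fin (length Z) → Set
    Witness i (inj₁ k) = Fin.toℕ k ≡ s i
    Witness i (inj₂ k) = Σ (Fin (suc (len (P i)))) λ j → lookup Z k ≡ pv (P i) j

    classify : ∀ i → ¬ Good i → Σ (Fin n ⊎ Fin (length Z)) (Witness i)
    classify i ¬good with n ≤? s i
    ... | no n≰s = inj₁ (Fin.fromℕ< (≰⇒> n≰s)) , toℕ-fromℕ< _
    ... | yes n≤s with ¬∀⇒∃¬ (λ avoid → ¬good (n≤s , avoid))
    ... | j , ¬∉ = inj₂ (Any.index (dne ¬∉)) , j , sym (lookup-index (dne ¬∉))

    witnesses-disjoint : ∀ {i i′} → i ≢ i′ → ∀ c → Witness i c → Witness i′ c → ⊥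
    witnesses-disjoint {i} {i′} i≢i′ (inj₁ k) w w′ =
      disjoint i i′ i≢i′ Fin.zero Fin.zero
        (trans (first i) (trans (cong (r S) (trans (sym w) w′)) (sym (first i′))))
    witnesses-disjoint {i} {i′} i≢i′ (inj₂ k) (j , w) (j′ , w′) =
      disjoint i i′ i≢i′ j j′ (trans (sym w) w′)

    collision : ((i : ℕ) → Σ (Fin n ⊎ Fin (length Z)) (Witness i)) → ⊥
    collision code with pigeonhole (n<1+n (n + length Z)) (join n (length Z) ∘ proj₁ ∘ code ∘ Fin.toℕ)
    ... | i , i′ , i<i′ , same =
      witnesses-disjoint (<⇒≢ i<i′) (proj₁ (code (Fin.toℕ i))) (proj₂ (code (Fin.toℕ i)))
        (subst (Witness (Fin.toℕ i′)) (sym same-code) (proj₂ (code (Fin.toℕ i′))))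
      where
      same-code : proj₁ (code (Fin.toℕ i)) ≡ proj₁ (code (Fin.toℕ i′))
      same-code = trans (sym (splitAt-join n (length Z) _)) (trans (cong (splitAt n) same) (splitAt-join n (length Z) _))

  -- some tooth path avoids the finite separator and joins a tail of R to its tooth
  InClosure⇒⊈ : ∀ {U} R X Y → InClosure G U R → PreTangleOf G R (X , Y) → ¬ (_⊆_ G U X)
  InClosure⇒⊈ {U} R X Y (S , S~R , P , first , _ , disjoint , teeth) (_ , (Z , Z-covers) , n , R-tail , reached) U⊆X
    with S~R Z
  ... | nS , nR , S-avoids , R-avoids , S→R
    with disjoint-paths-avoid P S (proj₁ ∘ first) (proj₂ ∘ first) disjoint Z nS
  ... | i , nS≤si , P-avoids = proj₂ (reached (lastV G (P i)) R→tooth) (U⊆X _ (teeth i))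
    where
    Outside : VSet G
    Outside v = ¬ (_∩_ G X Y) v
    off-Z : ∀ v → v ∉ Z → Outside v
    off-Z v v∉Z v∈X∩Y = v∉Z (Z-covers v v∈X∩Y)
    R→tooth : Walk G Outside (r R n) (lastV G (P i))
    R→tooth =
      ray-walk R (n ⊔ nR) (m≤m⊔n n nR) R-tail
      ++ʷ reverseʷ (ray-walk R (n ⊔ nR) (m≤n⊔m n nR) (λ k le → off-Z _ (R-avoids k le)))
      ++ʷ reverseʷ (mapʷ off-Z S→R)
      ++ʷ ray-walk S (proj₁ (first i)) nS≤si (λ k le → off-Z _ (S-avoids k le))
      ++ʷ subst (λ x → Walk G Outside x (lastV G (P i))) (proj₂ (first i))
            (path-walk (P i) (λ j → off-Z _ (P-avoids j)))

  pre-tangle-asym : ∀ R X Y → PreTangleOf G R (X , Y) → ¬ PreTangleOf G R (Y , X)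
  pre-tangle-asym R X Y (_ , _ , n , tail , reached) (_ , _ , n′ , tail′ , reached′) =
    proj₂ (reached _ (ray-walk R (n ⊔ n′) (m≤m⊔n n n′) tail))
          (proj₁ (reached′ _ (ray-walk R (n ⊔ n′) (m≤n⊔m n n′) tail′)))

  module Cut (L : List V) (x : V) where
    Reached C D : VSet G
    Reached = Walk G (_∉ L) x
    C v = Reached v ⊎ v ∈ L
    D v = ¬ Reached v

    separation : IsSeparation G C D
    separation = covers , λ u v e (Cu , ¬Du) (_ , ¬Cv) → ¬Cv (inj₁ (extendʷ (dne ¬Du) e (¬Cv ∘ inj₂)))
      where
      covers : ∀ v → C v ⊎ D v
      covers v with em {Reached v}
      ... | yes reached = inj₁ (inj₁ reached)
      ... | no ¬reached = inj₂ ¬reached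

    ∈L⇒separator : ∀ {v} → v ∈ L → C v × D v
    ∈L⇒separator v∈L = inj₂ v∈L , λ reached → walk-end reached v∈L

    separator⇒∈L : ∀ {v} → C v → D v → v ∈ L
    separator⇒∈L (inj₁ reached) ¬reached = ⊥-elim (¬reached reached)
    separator⇒∈L (inj₂ v∈L) _ = v∈L

  DistinguishedIn : ∀ {ℓ} → (VSet G → VSet G → Set ℓ) → Ray G → Ray G → Set (lsuc 0ℓ ⊔ˡ ℓ)
  DistinguishedIn S R R′ =
    Σ (VSet G) λ C → Σ (VSet G) λ D → S C D × Distinguishes G C D (PreTangleOf G R) (PreTangleOf G R′)

  distinguishes⇒opposite : ∀ {C D P Q} → Distinguishes G C D P Q
    → (P (C , D) × Q (D , C)) ⊎ (P (D , C) × Q (C , D))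
  distinguishes⇒opposite (inj₁ p , inj₁ q , ¬same) = ⊥-elim (¬same (inj₁ (p , q)))
  distinguishes⇒opposite (inj₁ p , inj₂ q , _) = inj₁ (p , q)
  distinguishes⇒opposite (inj₂ p , inj₁ q , _) = inj₂ (p , q)
  distinguishes⇒opposite (inj₂ p , inj₂ q , ¬same) = ⊥-elim (¬same (inj₂ (p , q)))

  inequivalent⇒distinguished : ∀ R R′ → ¬ (_~_ G R′ R) → DistinguishedIn (IsSeparation G) R R′
  inequivalent⇒distinguished R R′ R′≁R with ¬∀⇒∃¬ R′≁R
  ... | L , unlinked with ray-eventually-avoids R′ L | ray-eventually-avoids R L
  ... | m , R′-avoids | n , R-avoids =
    C , D , separation , inj₁ R-side , inj₂ R′-side , λ where
      (inj₁ (_ , R′-CD)) → pre-tangle-asym R′ D C R′-side R′-CD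
      (inj₂ (R-DC , _)) → pre-tangle-asym R C D R-side R-DC
    where
    open Cut L (r R′ m)

    R′-side : PreTangleOf G R′ (D , C)
    R′-side = separation-swap separation , (L , λ v (d , c) → separator⇒∈L c d)
      , m , (λ k m≤k (d , c) → R′-avoids k m≤k (separator⇒∈L c d))
      , λ v w → let reached = transportʷ Reached extend w (here (R′-avoids m ≤-refl))
                in inj₁ reached , λ ¬r → ¬r reached
      where
      extend : ∀ {u v} → ¬ (_∩_ G D C u) → ¬ (_∩_ G D C v) → E u v → Reached u → Reached v
      extend _ ¬DCv e reached = extendʷ reached e (¬DCv ∘ Data.Product.swap ∘ ∈L⇒separator)

    R-side : PreTangleOf G R (C , D)
    R-side = separation , (L , λ v (c , d) → separator⇒∈L c d)
      , n , (λ k n≤k (c , d) → R-avoids k n≤k (separator⇒∈L c d))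
      , λ v w → unreached w , λ where
          (inj₁ reached) → unreached w reached
          (inj₂ v∈L) → walk-end w (∈L⇒separator v∈L)
      where
      unreached : ∀ {v} → Walk G (λ u → ¬ (_∩_ G C D u)) (r R n) v → D v
      unreached w reached = unlinked (m , n , R′-avoids , R-avoids ,
        reached ++ʷ reverseʷ (mapʷ (λ u ¬CD u∈L → ¬CD (∈L⇒separator u∈L)) w))

module Limit (em : ExcludedMiddle 0ℓ) (G : Graph) (As Bs : ℕ → VSet G)
             (strict : ∀ i j → i < j → _<ₛ_ G (As i , Bs i) (As j , Bs j)) where
  open Graph G
  open Classical em
  open Separations em G
  open Ends em G

  A B U : VSet G
  A = LimA G As
  B = LimB G Bs
  U = _∩_ G A B

  stage-mono : ∀ {k i} → k ≤ i → _≤ₛ_ G (As k , Bs k) (As i , Bs i)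
  stage-mono {k} {i} k≤i with m≤n⇒m<n∨m≡n k≤i
  ... | inj₁ k<i = proj₁ (strict k i k<i)
  ... | inj₂ refl = (λ _ a → a) , (λ _ b → b)

  As-mono : ∀ {k i} → k ≤ i → _⊆_ G (As k) (As i)
  As-mono = proj₁ ∘ stage-mono

  Bs-anti : ∀ {k i} → k ≤ i → _⊆_ G (Bs i) (Bs k)
  Bs-anti = proj₂ ∘ stage-mono

  LimA-⊆-side : ∀ {X Y} → (∀ i → _⊆_ G (As i) X ⊎ _⊆_ G (As i) Y) → _⊆_ G A X ⊎ _⊆_ G A Y
  LimA-⊆-side {X} {Y} sided with em {∀ j → Σ ℕ λ i → j ≤ i × _⊆_ G (As i) Y}
  ... | yes cofinal = inj₂ λ where
    v (k , a) → let i , k≤i , As⊆Y = cofinal k in As⊆Y v (As-mono k≤i v a)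
  ... | no ¬cofinal with ¬∀⇒∃¬ ¬cofinal
  ... | j , ¬beyond = inj₁ λ where
    v (k , a) → Data.Sum.[ (λ As⊆X → As⊆X v (As-mono (m≤n+m k j) v a))
                         , (λ As⊆Y → ⊥-elim (¬beyond (j + k , m≤m+n j k , As⊆Y))) ]′ (sided (j + k))

  closure-ends-inseparable : ∀ R R′ X Y → InClosure G U R → InClosure G U R′
    → PreTangleOf G R (X , Y) → PreTangleOf G R′ (Y , X)
    → (∀ i → SideWithin (As i) (Bs i) X Y) → ⊥
  closure-ends-inseparable R R′ X Y cR cR′ pR pR′ within with LimA-⊆-side A-sided
    where
    A-sided : ∀ i → _⊆_ G (As i) X ⊎ _⊆_ G (As i) Y
    A-sided i with within i
    ... | inj₁ As-sided = As-sided
    ... | inj₂ (inj₁ Bs⊆X) = ⊥-elim (InClosure⇒⊈ {U} R X Y cR pR λ v u → Bs⊆X v (proj₂ u i))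
    ... | inj₂ (inj₂ Bs⊆Y) = ⊥-elim (InClosure⇒⊈ {U} R′ Y X cR′ pR′ λ v u → Bs⊆Y v (proj₂ u i))
  ... | inj₁ A⊆X = InClosure⇒⊈ {U} R X Y cR pR λ v u → A⊆X v (proj₁ u)
  ... | inj₂ A⊆Y = InClosure⇒⊈ {U} R′ Y X cR′ pR′ λ v u → A⊆Y v (proj₁ u)

  closure-ends-equivalent : (N : SepSet G) → IsNestedSet G N → (∀ i → _∈⃗_ G (As i , Bs i) N)
    → (∀ R R′ → InClosure G U R → InClosure G U R′
              → DistinguishedIn (IsSeparation G) R R′ → DistinguishedIn N R R′)
    → ∀ R R′ → InClosure G U R → InClosure G U R′ → _~_ G R′ R
  closure-ends-equivalent N nested stages-in-N N-distinguishes R R′ cR cR′ = dne λ R′≁R →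
    let C , D , N-CD , distinguishes = N-distinguishes R R′ cR cR′ (inequivalent⇒distinguished R R′ R′≁R)
        within : ∀ i → SideWithin (As i) (Bs i) C D
        within i = Data.Sum.[ (λ N-AB → nested⇒side-within (nested N-AB N-CD))
                            , (λ N-BA → side-within-swapˡ (nested⇒side-within (nested N-BA N-CD))) ]′ (stages-in-N i)
    in Data.Sum.[ (λ (pR , pR′) → closure-ends-inseparable R R′ C D cR cR′ pR pR′ within)
                , (λ (pR , pR′) → closure-ends-inseparable R R′ D C cR cR′ pR pR′ (side-within-swapʳ ∘ within))
                ]′ (distinguishes⇒opposite {C} {D} {PreTangleOf G R} {PreTangleOf G R′} distinguishes)

  stage-containing : (L : List V) → Σ ℕ λ i → ∀ v → v ∈ L → A v → As i v
  stage-containing [] = 0 , λ _ ()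
  stage-containing (x ∷ L) with stage-containing L | em {A x}
  ... | i , covered | no ¬Ax = i , λ where
    v (here refl) Av → ⊥-elim (¬Ax Av)
    v (there v∈L) Av → covered v v∈L Av
  ... | i , covered | yes (k , Ak) = k ⊔ i , λ where
    v (here refl) _ → As-mono (m≤m⊔n k i) v Ak
    v (there v∈L) Av → As-mono (m≤n⊔m k i) v (covered v v∈L Av)

  limit-separation : (∀ i → IsSeparation G (As i) (Bs i)) → IsSeparation G A B
  limit-separation stage = covers , no-edge
    where
    covers : ∀ v → A v ⊎ B v
    covers v with em {A v}
    ... | yes Av = inj₁ Av
    ... | no ¬Av = inj₂ λ i → covers-other (stage i) (¬Av ∘ (i ,_))
    no-edge : ∀ u v → E u v → (_∖_ G A B) u → (_∖_ G B A) v → ⊥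
    no-edge u v e ((k , Aku) , ¬Bu) (Bv , ¬Av) with ¬∀⇒∃¬ ¬Bu
    ... | j , ¬Bju = proj₂ (stage (j + k)) u v e
      (As-mono (m≤n+m k j) u Aku , ¬Bju ∘ Bs-anti (m≤m+n j k) u)
      (Bv (j + k) , λ Av → ¬Av (j + k , Av))

module TightLimit (em : ExcludedMiddle 0ℓ) (G : Graph) (conn : Connected G) (lf : LocallyFinite G)
                  (As Bs : ℕ → VSet G)
                  (strict : ∀ i j → i < j → _<ₛ_ G (As i , Bs i) (As j , Bs j))
                  (tight : ∀ i → IsTightSep G (As i) (Bs i))
                  (B-nonempty : Σ (Graph.V G) (LimB G Bs)) where
  open Graph G
  open Classical em
  open Separations em G
  open Limit em G As Bs strict

  stage-separation : ∀ i → IsSeparation G (As i) (Bs i)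
  stage-separation = proj₁ ∘ tight

  A|B : IsSeparation G A B
  A|B = limit-separation stage-separation

  B|A : IsSeparation G B A
  B|A = separation-swap A|B

  U-nonempty : Σ V U
  U-nonempty =
    let K , (((a , Ka) , _) , _) , K⊆A₀∖B₀ = proj₁ (proj₂ (tight 0))
        b , Bb = B-nonempty
    in walk-crosses-separator A|B (conn a b) (0 , proj₁ (K⊆A₀∖B₀ a Ka)) Bb

  -- the tight component of stage i on the side of B sees the whole separator and lies in B ∖ A;
  -- a vertex of that separator next to it lies in B
  separator⊆U : ∀ i → _⊆_ G U (As i) → (∀ x y → U x → E x y → A y → As i y)
              → _⊆_ G (_∩_ G (As i) (Bs i)) U
  separator⊆U i U⊆Asi A-neighbours s s∈sep with tight i | U-nonempty
  ... | _ , _ , K , ((_ , K-avoids , K-connected , _) , _ , sep⊆N) , K⊆Bs∖As | x₀ , x₀∈U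
    with sep⊆N x₀ (U⊆Asi x₀ x₀∈U , proj₂ x₀∈U i) | sep⊆N s s∈sep
  ... | _ , c , Kc , cx₀ | _ , c′ , Kc′ , c′s = (i , proj₁ s∈sep) , neighbour-stays B|A c′∈B∖A c′s
    where
    U⊆sep : _⊆_ G U (_∩_ G (As i) (Bs i))
    U⊆sep v Uv = U⊆Asi v Uv , proj₂ Uv i
    ¬Ac : ¬ A c
    ¬Ac Ac = proj₂ (K⊆Bs∖As c Kc) (A-neighbours x₀ c x₀∈U (E-sym cx₀) Ac)
    c∈B∖A : (_∖_ G B A) c
    c∈B∖A = covers-other A|B ¬Ac , ¬Ac
    c′∈B∖A : (_∖_ G B A) c′
    c′∈B∖A = stays-on-side B|A (λ v Kv (Bv , Av) → K-avoids v Kv (U⊆sep v (Av , Bv)))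
               (K-connected c c′ Kc Kc′) c∈B∖A

  neighbours : List V → List V
  neighbours = concatMap (proj₁ ∘ lf)

  ∈-neighbours : ∀ {xs x y} → x ∈ xs → E x y → y ∈ neighbours xs
  ∈-neighbours x∈xs e = ∈-concatMap⁺ (proj₁ ∘ lf) (lose x∈xs (proj₂ (lf _) _ e))

  stage-absorbing-U-impossible : ∀ i → _⊆_ G U (As i) → (∀ x y → U x → E x y → A y → As i y) → ⊥
  stage-absorbing-U-impossible i U⊆Asi A-neighbours
    with <ₛ⇒new-vertex (stage-separation (suc i)) (strict i (suc i) ≤-refl)
           (λ v s∈sep → proj₂ (separator⊆U i U⊆Asi A-neighbours v s∈sep) (suc i))
       | U-nonempty
  ... | v , As′v , ¬Asv | x₀ , x₀∈U with walk-enters (conn v x₀) (¬Asv ∘ U⊆Asi v) x₀∈U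
  ... | y , x′ , v→y , yx′ , x′∈U =
    proj₂ y∈Bs∖As (A-neighbours x′ y x′∈U (E-sym yx′) (proj₁ y∈A∖B))
    where
    sep⊆U : _⊆_ G (_∩_ G (As i) (Bs i)) U
    sep⊆U = separator⊆U i U⊆Asi A-neighbours
    y∈A∖B : (_∖_ G A B) y
    y∈A∖B = stays-on-side A|B (λ _ ¬U → ¬U) v→y
              ((suc i , As′v) , λ Bv → ¬Asv (U⊆Asi v ((suc i , As′v) , Bv)))
    y∈Bs∖As : (_∖_ G (Bs i) (As i)) y
    y∈Bs∖As = stays-on-side (separation-swap (stage-separation i)) (λ w ¬Uw (Bw , Aw) → ¬Uw (sep⊆U w (Aw , Bw)))
                v→y (covers-other (stage-separation i) ¬Asv , ¬Asv)

  U-infinite : ¬ Finite G U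
  U-infinite (xs , U⊆xs) =
    let I , covered = stage-containing (xs ++ neighbours xs)
    in stage-absorbing-U-impossible I (λ v Uv → covered v (∈-++⁺ˡ (U⊆xs v Uv)) (proj₁ Uv))
         (λ x y Ux e → covered y (∈-++⁺ʳ xs (∈-neighbours (U⊆xs x Ux) e)))

module Comb (em : ExcludedMiddle 0ℓ) (G : Graph) (conn : Connected G) (lf : LocallyFinite G)
            (U : VSet G) (U-infinite : ¬ Finite G U) where
  open Graph G
  open Classical em
  open Ends em G using (~-refl)

  infinite⇒nonempty : ∀ {X} → ¬ Finite G X → Σ V X
  infinite⇒nonempty ¬finite = dne λ empty → ¬finite ([] , λ v Xv → ⊥-elim (empty (v , Xv)))

  enumerate : VSet G → List V
  enumerate X with em {Finite G X}
  ... | yes (xs , _) = xs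
  ... | no _ = []

  enumerate-complete : ∀ X → Finite G X → _⊆_ G X (_∈ enumerate X)
  enumerate-complete X finite with em {Finite G X}
  ... | yes (_ , complete) = complete
  ... | no ¬finite = ⊥-elim (¬finite finite)

  root : V
  root = proj₁ (infinite⇒nonempty U-infinite)

  data Reach : ℕ → V → Set where
    reach-root : Reach 0 root
    reach-step : ∀ {n x y} → Reach n x → E x y → Reach (suc n) y

  reach-along : ∀ {n x y} → Reach n x → Walk G (λ _ → ⊤) x y → Σ ℕ λ m → Reach m y
  reach-along reach (here _) = _ , reach
  reach-along reach (step _ e w) = reach-along (reach-step reach e) w

  depth-minimal : ∀ v → Σ ℕ (Least (λ n → Reach n v))
  depth-minimal v = least (λ n → Reach n v) (reach-along reach-root (conn root v))

  opaque
    depth : V → ℕ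
    depth v = proj₁ (depth-minimal v)

    depth-reach : ∀ v → Reach (depth v) v
    depth-reach v = proj₁ (proj₂ (depth-minimal v))

    depth-min : ∀ v m → Reach m v → depth v ≤ m
    depth-min v m reach = ≮⇒≥ λ m<depth → proj₂ (proj₂ (depth-minimal v)) m m<depth reach

  depth≡0⇒root : ∀ {v} → depth v ≡ 0 → v ≡ root
  depth≡0⇒root {v} eq = reach-0 (subst (λ n → Reach n v) eq (depth-reach v))
    where
    reach-0 : ∀ {v} → Reach 0 v → v ≡ root
    reach-0 reach-root = refl

  depth-root : depth root ≡ 0
  depth-root = n≤0⇒n≡0 (depth-min root 0 reach-root)

  -- at the root, which has no parent, the junk value is the root itself
  parent-of : ∀ v → Σ V λ p → ∀ n → depth v ≡ suc n → E p v × depth p ≡ n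
  parent-of v with depth v | depth-reach v | depth-min v
  ... | zero | _ | _ = v , λ _ ()
  ... | suc n | reach-step {x = p} reach-p e | minimal = p , λ where
    _ refl → e , ≤-antisym (depth-min p n reach-p) (≤-pred (minimal _ (reach-step (depth-reach p) e)))

  opaque
    parent : V → V
    parent v = proj₁ (parent-of v)

    parent-edge : ∀ {v n} → depth v ≡ suc n → E (parent v) v
    parent-edge {v} eq = proj₁ (proj₂ (parent-of v) _ eq)

    depth-parent : ∀ {v n} → depth v ≡ suc n → depth (parent v) ≡ n
    depth-parent {v} eq = proj₂ (proj₂ (parent-of v) _ eq)

  up : ℕ → V → V
  up zero v = v
  up (suc k) v = parent (up k v)

  ∸-suc : ∀ {k d} → k < d → d ∸ k ≡ suc (d ∸ suc k)
  ∸-suc {k} {suc d} (s≤s k≤d) = +-∸-assoc 1 k≤d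

  depth-up : ∀ k v → k ≤ depth v → depth (up k v) ≡ depth v ∸ k
  depth-up zero v _ = refl
  depth-up (suc k) v k<d = depth-parent (trans (depth-up k v (<⇒≤ k<d)) (∸-suc k<d))

  ancestor : ℕ → V → V
  ancestor j v = up (depth v ∸ j) v

  depth-ancestor : ∀ {j v} → j ≤ depth v → depth (ancestor j v) ≡ j
  depth-ancestor {j} {v} j≤d = trans (depth-up (depth v ∸ j) v (m∸n≤m (depth v) j)) (m∸[m∸n]≡n j≤d)

  ancestor-edge : ∀ {j v} → j < depth v → E (ancestor j v) (ancestor (suc j) v)
  ancestor-edge {j} {v} j<d =
    subst (λ k → E (up k v) (ancestor (suc j) v)) (sym (∸-suc j<d)) (parent-edge (depth-ancestor j<d))

  ancestor-self : ∀ v → ancestor (depth v) v ≡ v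
  ancestor-self v = cong (λ k → up k v) (n∸n≡0 (depth v))

  Below : V → V → Set
  Below w v = depth w ≤ depth v × ancestor (depth w) v ≡ w

  ancestor-below : ∀ {j v} → j ≤ depth v → Below (ancestor j v) v
  ancestor-below {j} {v} j≤d rewrite depth-ancestor j≤d = j≤d , refl

  below-root : ∀ v → Below root v
  below-root v rewrite depth-root = z≤n , depth≡0⇒root (depth-ancestor z≤n)

  Fertile : V → Set
  Fertile w = ¬ Finite G (λ v → U v × Below w v)

  root-fertile : Fertile root
  root-fertile (xs , complete) = U-infinite (xs , λ v Uv → complete v (Uv , below-root v))

  below-children : V → List V
  below-children w = concatMap (λ c → enumerate (λ v → U v × Below c v)) (proj₁ (lf w))

  -- König's lemma: the finitely many children of w cannot all have finitely many vertices of U below them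
  fertile-child : ∀ w → Fertile w → Σ V λ c → E w c × depth c ≡ suc (depth w) × Fertile c
  fertile-child w fertile = dne λ ¬child → fertile (w ∷ below-children w , covered ¬child)
    where
    covered : ¬ (Σ V λ c → E w c × depth c ≡ suc (depth w) × Fertile c)
            → ∀ v → U v × Below w v → v ∈ (w ∷ below-children w)
    covered ¬child v (Uv , dw≤dv , v↑≡w) with m≤n⇒m<n∨m≡n dw≤dv
    ... | inj₂ dw≡dv =
      here (trans (sym (ancestor-self v)) (trans (cong (λ j → ancestor j v) (sym dw≡dv)) v↑≡w))
    ... | inj₁ dw<dv =
      there (∈-concatMap⁺ _ (lose (proj₂ (lf w) c wc) (enumerate-complete _ c-barren v (Uv , v-below-c))))
      where
      c = ancestor (suc (depth w)) v
      dc : depth c ≡ suc (depth w)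
      dc = depth-ancestor dw<dv
      wc : E w c
      wc = subst (λ x → E x c) v↑≡w (ancestor-edge dw<dv)
      c-barren : Finite G (λ v → U v × Below c v)
      c-barren = dne λ c-fertile → ¬child (c , wc , dc , c-fertile)
      v-below-c : Below c v
      v-below-c = ancestor-below dw<dv

  opaque
    spine-node : ℕ → Σ V Fertile
    spine-node zero = root , root-fertile
    spine-node (suc n) with fertile-child (proj₁ (spine-node n)) (proj₂ (spine-node n))
    ... | c , _ , _ , c-fertile = c , c-fertile

    spine-at : ℕ → V
    spine-at n = proj₁ (spine-node n)

    spine-step : ∀ n → E (spine-at n) (spine-at (suc n)) × depth (spine-at (suc n)) ≡ suc (depth (spine-at n))
    spine-step n with fertile-child (proj₁ (spine-node n)) (proj₂ (spine-node n))
    ... | c , wc , dc , _ = wc , dc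

    spine-fertile : ∀ n → Fertile (spine-at n)
    spine-fertile n = proj₂ (spine-node n)

    depth-spine : ∀ n → depth (spine-at n) ≡ n
    depth-spine zero = depth-root
    depth-spine (suc n) = trans (proj₂ (spine-step n)) (cong suc (depth-spine n))

  spine : Ray G
  spine = record
    { r = spine-at
    ; r-inj = λ m n eq → trans (sym (depth-spine m)) (trans (cong depth eq) (depth-spine n))
    ; r-adj = proj₁ ∘ spine-step
    }

  module AncestorPath (u : V) (J : ℕ) (J≤d : J ≤ depth u) where
    vertex : Fin (suc (depth u ∸ J)) → V
    vertex a = ancestor (J + Fin.toℕ a) u

    within : ∀ a → J + Fin.toℕ a ≤ depth u
    within a = ≤-trans (+-monoʳ-≤ J (≤-pred (toℕ<n a))) (≤-reflexive (m+[n∸m]≡n J≤d))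

    depth-vertex : ∀ a → depth (vertex a) ≡ J + Fin.toℕ a
    depth-vertex a = depth-ancestor (within a)

    path : FinPath G
    path = record
      { len = depth u ∸ J
      ; pv = vertex
      ; pinj = λ a b eq → toℕ-injective (+-cancelˡ-≡ J _ _
          (trans (sym (depth-vertex a)) (trans (cong depth eq) (depth-vertex b))))
      ; padj = λ i → subst₂ (λ j k → E (ancestor j u) (ancestor k u))
          (cong (J +_) (sym (toℕ-inject₁ i))) (sym (+-suc J (Fin.toℕ i)))
          (ancestor-edge (subst (_≤ depth u) (+-suc J (Fin.toℕ i)) (within (Fin.suc i))))
      }

    path-first : firstV G path ≡ ancestor J u
    path-first = cong (λ j → ancestor j u) (+-identityʳ J)

    path-last : lastV G path ≡ u
    path-last = trans (cong (λ j → ancestor (J + j) u) (toℕ-fromℕ (depth u ∸ J)))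
                      (trans (cong (λ j → ancestor j u) (m+[n∸m]≡n J≤d)) (ancestor-self u))

  spine-below-bound : ∀ {j u} → Below (spine-at j) u → j ≤ depth u
  spine-below-bound {j} (dj≤du , _) = subst (_≤ depth _) (depth-spine j) dj≤du

  record Tooth (u : V) (t : ℕ) : Set where
    field
      path : FinPath G
      start : ℕ
      starts-on-spine : firstV G path ≡ spine-at start
      meets-spine-once : ∀ j n → pv path j ≡ spine-at n → j ≡ Fin.zero
      ends-at : lastV G path ≡ u
      depths-within : ∀ j → t ≤ depth (pv path j) × depth (pv path j) ≤ depth u

  -- the tooth leaves the spine at the deepest spine vertex above u
  tooth : ∀ u t → Below (spine-at t) u → Tooth u t
  tooth u t below with greatest (λ j → Below (spine-at j) u) (depth u) (λ j → spine-below-bound) (t , below)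
  ... | J , below-J , maximal = record
    { path = path
    ; start = J
    ; starts-on-spine = trans path-first (subst (λ j → ancestor j u ≡ spine-at J) (depth-spine J) (proj₂ below-J))
    ; meets-spine-once = meets-spine-once
    ; ends-at = path-last
    ; depths-within = λ a → subst (t ≤_) (sym (depth-vertex a)) (≤-trans t≤J (m≤m+n J _))
                          , subst (_≤ depth u) (sym (depth-vertex a)) (within a)
    }
    where
    open AncestorPath u J (spine-below-bound below-J)
    t≤J : t ≤ J
    t≤J = ≮⇒≥ λ J<t → maximal t J<t below
    meets-spine-once : ∀ a n → vertex a ≡ spine-at n → a ≡ Fin.zero
    meets-spine-once Fin.zero n _ = refl
    meets-spine-once (Fin.suc a) n eq =
      ⊥-elim (maximal n J<n (subst (λ x → Below x u) eq (ancestor-below (within (Fin.suc a)))))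
      where
      J<n : J < n
      J<n = subst (J <_) (trans (sym (depth-vertex (Fin.suc a))) (trans (cong depth eq) (depth-spine n))) (m<m+n J z<s)

  vertex-below : ∀ t → Σ V λ u → U u × Below (spine-at t) u
  vertex-below t = infinite⇒nonempty (spine-fertile t)

  -- the i-th tooth ends at u i; the next one starts strictly deeper than u i
  level : ℕ → ℕ
  u : ℕ → V
  level zero = 0
  level (suc i) = suc (depth (u i))
  u i = proj₁ (vertex-below (level i))

  level≤depth : ∀ i → level i ≤ depth (u i)
  level≤depth i = spine-below-bound (proj₂ (proj₂ (vertex-below (level i))))

  level-separates : ∀ {i i′} → i < i′ → depth (u i) < level i′
  level-separates {i} {suc i′} (s≤s i≤i′) with m≤n⇒m<n∨m≡n i≤i′
  ... | inj₂ refl = ≤-refl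
  ... | inj₁ i<i′ = m≤n⇒m≤1+n (≤-trans (level-separates i<i′) (level≤depth i′))

  teeth : ∀ i → Tooth (u i) (level i)
  teeth i = tooth (u i) (level i) (proj₂ (proj₂ (vertex-below (level i))))

  tooth-vertex : ∀ i → Fin (suc (len (Tooth.path (teeth i)))) → V
  tooth-vertex i = pv (Tooth.path (teeth i))

  teeth-disjoint-< : ∀ {i i′} → i < i′ → ∀ j j′ → tooth-vertex i j ≢ tooth-vertex i′ j′
  teeth-disjoint-< {i} {i′} i<i′ j j′ eq =
    <⇒≱ (≤-<-trans (proj₂ (Tooth.depths-within (teeth i) j)) (level-separates i<i′))
        (subst (level i′ ≤_) (cong depth (sym eq)) (proj₁ (Tooth.depths-within (teeth i′) j′)))

  teeth-disjoint : ∀ i i′ → i ≢ i′ → ∀ j j′ → tooth-vertex i j ≢ tooth-vertex i′ j′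
  teeth-disjoint i i′ i≢i′ j j′ eq with <-cmp i i′
  ... | tri< i<i′ _ _ = teeth-disjoint-< i<i′ j j′ eq
  ... | tri≈ _ i≡i′ _ = i≢i′ i≡i′
  ... | tri> _ _ i′<i = teeth-disjoint-< i′<i j′ j (sym eq)

  comb-exists : Σ (Ray G) (InClosure G U)
  comb-exists = spine , spine , ~-refl spine , Tooth.path ∘ teeth
    , (λ i → Tooth.start (teeth i) , Tooth.starts-on-spine (teeth i))
    , Tooth.meets-spine-once ∘ teeth
    , teeth-disjoint
    , λ i → subst U (sym (Tooth.ends-at (teeth i))) (proj₁ (proj₂ (vertex-below (level i))))

lemma5p3 : ExcludedMiddle 0ℓ → ExcludedMiddle (lsuc 0ℓ) → ExcludedMiddle (lsuc (lsuc 0ℓ))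
    → (G : Graph) → Connected G → LocallyFinite G
    → (N : SepSet G) → (∀ {C D} → N C D → IsSeparation G C D) → IsNestedSet G N
    → (As Bs : ℕ → VSet G)
    → (∀ i → _∈⃗_ G (As i , Bs i) N)
    → (∀ i → IsTightSep G (As i) (Bs i))
    → (∀ i j → i < j → _<ₛ_ G (As i , Bs i) (As j , Bs j))
    → Σ (Graph.V G) (LimB G Bs)
    → (∀ R R' → InClosure G (_∩_ G (LimA G As) (LimB G Bs)) R
              → InClosure G (_∩_ G (LimA G As) (LimB G Bs)) R'
              → Σ (VSet G) (λ C → Σ (VSet G) λ D → IsSeparation G C D
                   × Distinguishes G C D (PreTangleOf G R) (PreTangleOf G R'))
              → Σ (VSet G) (λ C → Σ (VSet G) λ D → N C D
                   × Distinguishes G C D (PreTangleOf G R) (PreTangleOf G R')))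
    → Σ (Ray G) λ R → InClosure G (_∩_ G (LimA G As) (LimB G Bs)) R
        × (∀ R' → InClosure G (_∩_ G (LimA G As) (LimB G Bs)) R' → _~_ G R' R)
lemma5p3 em _ _ G conn lf N _ nested As Bs stages-in-N tight strict B-nonempty N-distinguishes =
  R , R∈closure , λ R′ R′∈closure →
    closure-ends-equivalent N nested stages-in-N N-distinguishes R R′ R∈closure R′∈closure
  where
  open Limit em G As Bs strict using (U; closure-ends-equivalent)
  open TightLimit em G conn lf As Bs strict tight B-nonempty using (U-infinite)
  open Comb em G conn lf U U-infinite using (comb-exists)
  R = proj₁ comb-exists
  R∈closure = proj₂ comb-exists
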